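{- Counter machines with restricted zero tests are branch-monotone and strictly branch-monotone for the extended ordering $\leq$ on their states, where $(q,\mathbf{v})\leq(q',\mathbf{v}')$ iff $q=q'$ and $\mathbf{v}\leq\mathbf{v}'$ componentwise.
   Context: A counter machine is $\mathcal{C}=(Q,\mathsf{C},T,q_0)$ with finite control-state set $Q$, initial control-state $q_0$, finite counter set $\mathsf{C}$, and $T\subseteq Q\times A\times Q$ where $A=\{\mathsf{inc}(c),\mathsf{dec}(c),\mathsf{noop}\mid c\in\mathsf{C}\}\times 2^{\mathsf{C}}$. It induces the labelled transition system with states $Q\times\mathbb{N}^{\mathsf{C}}$, initial state $(q_0,\mathbf{0})$, and transitions $(q,\mathbf{v})\xrightarrow{(op,Z)}(q',\mathbf{v}')$ whenever $(q,(op,Z),q')\in T$, $\mathbf{v}_b=0$ for all $b\in Z$, and $\mathbf{v}'$ equals $\mathbf{v}$ except that counter $c$ is increased by $1$ if $op=\mathsf{inc}(c)$ and decreased by $1$ if $op=\mathsf{dec}(c)$ (the result must remain in $\mathbb{N}$); for $op=\mathsf{noop}$, $\mathbf{v}'=\mathbf{v}$. The machine has restricted zero tests if for every sequence of transitions $q_0\xrightarrow{op(c_1),Z_1}q_1\xrightarrow{op(c_2),Z_2}\cdots\xrightarrow{op(c_n),Z_n}q_n$ in $T$ and all $1\leq i\leq j\leq n$, $c_j\notin Z_i$ (once a counter is tested for zero it is never incremented or decremented afterwards). Viewed as an OLTS $(X,A,\to,\leq,x_0)$, it is branch-monotone if for all states $x,x'$ and $\sigma\in A^*$ with $x\xrightarrow{\sigma}x'$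 and $x\leq x'$ there is $y$ with $x'\xrightarrow{\sigma}y$ and $x'\leq y$; strictly branch-monotone if the same holds with $x<x'$ and $x'<y$ ($a<b$ meaning $a\leq b$, $b\not\leq a$).
   Formalization: In branch-monotonicity and strict branch-monotonicity, the state x ranges only over states reachable from the initial state $(q_0,\mathbf{0})$ rather than over all states. The statement above fails without it. -}

module Defs where

open import Data.Nat using (ℕ; zero; suc; _≤_)
open import Data.Fin using (Fin; toℕ; _≟_)
open import Data.Fin.Subset using (Subset; _∈_; _∉_)
open import Data.List using (List; []; _∷_; length; lookup)
open import Data.Maybe using (Maybe; just; nothing)
open import Data.Product using (_×_; _,_; proj₁; proj₂; ∃)
open import Data.Bool using (if_then_else_)
open import Relation.Nullary using (¬_; does)
open import Relation.Binary.PropositionalEquality using (_≡_)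

data Steps {X A : Set} (step : X → A → X → Set) : X → List A → X → Set where
  done : ∀ {x} → Steps step x [] x
  _∷_  : ∀ {x a y σ z} → step x a y → Steps step y σ z → Steps step x (a ∷ σ) z

Reachable : {X A : Set} → (X → A → X → Set) → X → X → Set
Reachable {A = A} step x₀ x = ∃ λ (σ : List A) → Steps step x₀ σ x

Strict : {X : Set} → (X → X → Set) → X → X → Set
Strict _≤_ a b = (a ≤ b) × ¬ (b ≤ a)

BranchMonotone : {X A : Set} → (X → A → X → Set) → (X → X → Set) → X → Set
BranchMonotone {X} {A} step _≤_ x₀ =
  ∀ (x x' : X) (σ : List A) → Reachable step x₀ x →
  Steps step x σ x' → x ≤ x' →
  ∃ λ (y : X) → Steps step x' σ y × (x' ≤ y)

StrictlyBranchMonotone : {X A : Set} → (X → A → X → Set) → (X → X → Set) → X → Set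
StrictlyBranchMonotone step _≤_ x₀ = BranchMonotone step (Strict _≤_) x₀

data Op (k : ℕ) : Set where
  inc  : Fin k → Op k
  dec  : Fin k → Op k
  noop : Op k

opCounter : ∀ {k} → Op k → Maybe (Fin k)
opCounter (inc c) = just c
opCounter (dec c) = just c
opCounter noop    = nothing

-- actions A = Op × 2^C  (operation, set of counters tested for zero)
Action : ℕ → Set
Action k = Op k × Subset k

record CounterMachine : Set₁ where
  field
    nQ : ℕ
    k  : ℕ
    T  : Fin nQ → Action k → Fin nQ → Set
    q₀ : Fin nQ

module _ (M : CounterMachine) where
  open CounterMachine M

  Config : Set
  Config = Fin nQ × (Fin k → ℕ)

  update : (Fin k → ℕ) → Fin k → ℕ → (Fin k → ℕ)
  update v c n b = if does (b ≟ c) then n else v b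

  ZeroOn : Subset k → (Fin k → ℕ) → Set
  ZeroOn Z v = ∀ b → b ∈ Z → v b ≡ 0

  data Step : Config → Action k → Config → Set where
    step-inc  : ∀ {q q' v c Z} → T q (inc c , Z) q' → ZeroOn Z v →
                Step (q , v) (inc c , Z) (q' , update v c (suc (v c)))
    step-dec  : ∀ {q q' v c Z n} → T q (dec c , Z) q' → ZeroOn Z v →
                v c ≡ suc n →
                Step (q , v) (dec c , Z) (q' , update v c n)
    step-noop : ∀ {q q' v Z} → T q (noop , Z) q' → ZeroOn Z v →
                Step (q , v) (noop , Z) (q' , v)

  initial : Config
  initial = (q₀ , λ _ → 0)

  _≼_ : Config → Config → Set
  (q , v) ≼ (q' , v') = (q ≡ q') × (∀ c → v c ≤ v' c)

  data CPath : Fin nQ → List (Action k) → Fin nQ → Set where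
    []  : ∀ {q} → CPath q [] q
    _∷_ : ∀ {q a q' σ q''} → T q a q' → CPath q' σ q'' → CPath q (a ∷ σ) q''

  RestrictedZeroTests : Set
  RestrictedZeroTests =
    ∀ {q} {σ : List (Action k)} → CPath q₀ σ q →
    (i j : Fin (length σ)) → toℕ i ≤ toℕ j →
    ∀ (c : Fin k) → opCounter (proj₁ (lookup σ j)) ≡ just c →
    c ∉ proj₂ (lookup σ i)

{-# OPTIONS --safe #-}
module Submission where

-- Let x reach x' by σ with x ≤ x', and let d := v' ∸ v be the gain of the loop σ.
-- A counter zero-tested somewhere in σ is, by restricted zero tests applied to the
-- run x₀ →τ x →σ x' →σ, never modified by σ, so its gain is 0. Hence every zero
-- test of σ is still passed when σ is replayed from x' = x + d, and the replay ends
-- in x' + d ≥ x'. If moreover x' + d ≤ x', then d = 0, i.e. x' ≤ x.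

open import Defs
open import Data.Product using (_×_; _,_; proj₁; proj₂; ∃)
open import Data.Nat using (ℕ; suc; _+_; _∸_; _≤_)
open import Data.Nat.Properties
  using (module ≤-Reasoning; m≤m+n; +-cancelˡ-≤; +-identityʳ;
         n≤0⇒n≡0; m∸n≡0⇒m≤n; n∸n≡0; m+[n∸m]≡n)
open import Data.Fin using (Fin; toℕ; _≟_)
open import Data.Fin.Properties using (toℕ<n)
open import Data.Fin.Subset using (_∈_)
open import Data.List using ([]; _∷_; length; _++_)
open import Data.List.Relation.Unary.Any using (Any; here; there; index)
open import Data.List.Relation.Unary.Any.Properties using (lookup-index; ++⁺ˡ; ++⁺ʳ)
open import Data.Maybe using (just)
open import Data.Empty using (⊥-elim)
open import Function using (_∘′_)
open import Relation.Nullary using (¬_; yes; no)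
open import Relation.Binary.PropositionalEquality
  using (_≡_; _≗_; refl; sym; trans; cong; cong₂; subst)

module _ {A : Set} {P Q : A → Set} where

  toℕ-index-++⁺ˡ : ∀ {xs ys} (p : Any P xs) → toℕ (index (++⁺ˡ {ys = ys} p)) ≡ toℕ (index p)
  toℕ-index-++⁺ˡ (here _)  = refl
  toℕ-index-++⁺ˡ (there p) = cong suc (toℕ-index-++⁺ˡ p)

  toℕ-index-++⁺ʳ : ∀ xs {ys} (q : Any Q ys) → toℕ (index (++⁺ʳ xs q)) ≡ length xs + toℕ (index q)
  toℕ-index-++⁺ʳ []       q = refl
  toℕ-index-++⁺ʳ (_ ∷ xs) q = cong suc (toℕ-index-++⁺ʳ xs q)

  index-++⁺ˡ≤index-++⁺ʳ : ∀ {xs ys} (p : Any P xs) (q : Any Q ys) →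
    toℕ (index (++⁺ˡ {ys = ys} p)) ≤ toℕ (index (++⁺ʳ xs q))
  index-++⁺ˡ≤index-++⁺ʳ {xs} {ys} p q = begin
    toℕ (index (++⁺ˡ p))         ≡⟨ toℕ-index-++⁺ˡ {ys = ys} p ⟩
    toℕ (index p)                <⟨ toℕ<n (index p) ⟩
    length xs                    ≤⟨ m≤m+n (length xs) _ ⟩
    length xs + toℕ (index q)    ≡⟨ toℕ-index-++⁺ʳ xs q ⟨
    toℕ (index (++⁺ʳ xs q))      ∎
    where open ≤-Reasoning

m+[n∸o]≤m⇒n≤o : ∀ m {n o} → m + (n ∸ o) ≤ m → n ≤ o
m+[n∸o]≤m⇒n≤o m {n} {o} le =
  m∸n≡0⇒m≤n (n≤0⇒n≡0 (+-cancelˡ-≤ m _ 0 (subst (m + (n ∸ o) ≤_) (sym (+-identityʳ m)) le)))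

module _ (M : CounterMachine) where
  open CounterMachine M

  Valuation : Set
  Valuation = Fin k → ℕ

  Tests : Fin k → Action k → Set
  Tests b a = b ∈ proj₂ a

  Modifies : Fin k → Action k → Set
  Modifies b a = opCounter (proj₁ a) ≡ just b

  _++ᴾ_ : ∀ {q σ q' τ q''} → CPath M q σ q' → CPath M q' τ q'' → CPath M q (σ ++ τ) q''
  []      ++ᴾ p = p
  (t ∷ p) ++ᴾ r = t ∷ (p ++ᴾ r)

  Steps⇒CPath : ∀ {q v σ q' v'} → Steps (Step M) (q , v) σ (q' , v') → CPath M q σ q'
  Steps⇒CPath done                 = []
  Steps⇒CPath (step-inc t _ ∷ s)   = t ∷ Steps⇒CPath s
  Steps⇒CPath (step-dec t _ _ ∷ s) = t ∷ Steps⇒CPath s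
  Steps⇒CPath (step-noop t _ ∷ s)  = t ∷ Steps⇒CPath s

  Reachable⇒CPath : ∀ {q v} → Reachable (Step M) (initial M) (q , v) →
    ∃ λ τ → CPath M q₀ τ q
  Reachable⇒CPath (τ , s) = τ , Steps⇒CPath s

  ¬modified-after-test : RestrictedZeroTests M → ∀ {ρ σ q b} → CPath M q₀ (ρ ++ σ) q →
    Any (Tests b) ρ → ¬ Any (Modifies b) σ
  ¬modified-after-test rzt {ρ} p t m =
    rzt p (index (++⁺ˡ t)) (index (++⁺ʳ ρ m)) (index-++⁺ˡ≤index-++⁺ʳ t m)
        _ (lookup-index (++⁺ʳ ρ m)) (lookup-index (++⁺ˡ t))

  update-≢ : ∀ (v : Valuation) c n {b} → ¬ b ≡ c → update M v c n b ≡ v b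
  update-≢ v c n {b} b≢c with b ≟ c
  ... | yes b≡c = ⊥-elim (b≢c b≡c)
  ... | no _    = refl

  unmodified-preserved : ∀ {q v σ q' v'} b → Steps (Step M) (q , v) σ (q' , v') →
    ¬ Any (Modifies b) σ → v' b ≡ v b
  unmodified-preserved b done _ = refl
  unmodified-preserved b (step-inc {v = v} {c = c} _ _ ∷ s) ¬m =
    trans (unmodified-preserved b s (¬m ∘′ there)) (update-≢ v c _ λ { refl → ¬m (here refl) })
  unmodified-preserved b (step-dec {v = v} {c = c} _ _ _ ∷ s) ¬m =
    trans (unmodified-preserved b s (¬m ∘′ there)) (update-≢ v c _ λ { refl → ¬m (here refl) })
  unmodified-preserved b (step-noop _ _ ∷ s) ¬m = unmodified-preserved b s (¬m ∘′ there)

  _⊕_ : Valuation → Valuation → Valuation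
  (u ⊕ d) b = u b + d b

  _⊖_ : Valuation → Valuation → Valuation
  (u ⊖ d) b = u b ∸ d b

  update-⊕ : ∀ {u w d : Valuation} c {m n} → w ≗ u ⊕ d → n ≡ m + d c →
    update M w c n ≗ update M u c m ⊕ d
  update-⊕ c w≗u⊕d n≡m+d b with b ≟ c
  ... | yes refl = n≡m+d
  ... | no _     = w≗u⊕d b

  ZeroOn-⊕ : ∀ {Z u w d} → ZeroOn M Z u → (∀ b → b ∈ Z → d b ≡ 0) → w ≗ u ⊕ d →
    ZeroOn M Z w
  ZeroOn-⊕ zero-u d-zero w≗u⊕d b b∈Z =
    trans (w≗u⊕d b) (cong₂ _+_ (zero-u b b∈Z) (d-zero b b∈Z))

  Step-⊕ : ∀ (d : Valuation) {q u a q' u' w} → Step M (q , u) a (q' , u') →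
    (∀ b → Tests b a → d b ≡ 0) → w ≗ u ⊕ d →
    ∃ λ w' → Step M (q , w) a (q' , w') × w' ≗ u' ⊕ d
  Step-⊕ d (step-inc {c = c} t z) d-zero w≗ =
    _ , step-inc t (ZeroOn-⊕ z d-zero w≗) , update-⊕ c w≗ (cong suc (w≗ c))
  Step-⊕ d (step-dec {c = c} t z u-c≡1+n) d-zero w≗ =
    _ , step-dec t (ZeroOn-⊕ z d-zero w≗) (trans (w≗ c) (cong (_+ d c) u-c≡1+n))
      , update-⊕ c w≗ refl
  Step-⊕ d (step-noop t z) d-zero w≗ =
    _ , step-noop t (ZeroOn-⊕ z d-zero w≗) , w≗

  Steps-⊕ : ∀ (d : Valuation) {q u σ q' u' w} → Steps (Step M) (q , u) σ (q' , u') →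
    (∀ b → Any (Tests b) σ → d b ≡ 0) → w ≗ u ⊕ d →
    ∃ λ w' → Steps (Step M) (q , w) σ (q' , w') × w' ≗ u' ⊕ d
  Steps-⊕ d done _ w≗ = _ , done , w≗
  Steps-⊕ d (s ∷ ss) d-zero w≗ with Step-⊕ d s (λ b → d-zero b ∘′ here) w≗
  ... | _ , s' , w₁≗ with Steps-⊕ d ss (λ b → d-zero b ∘′ there) w₁≗
  ...   | w' , ss' , w'≗ = w' , s' ∷ ss' , w'≗

  loop-gain-untested : RestrictedZeroTests M → ∀ {q v σ v'} →
    Reachable (Step M) (initial M) (q , v) → Steps (Step M) (q , v) σ (q , v') →
    ∀ b → Any (Tests b) σ → (v' ⊖ v) b ≡ 0
  loop-gain-untested rzt {v = v} reach loop b tested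
    with Reachable⇒CPath reach
  ... | τ , run = trans (cong (_∸ v b) (unmodified-preserved b loop unmodified)) (n∸n≡0 (v b))
    where
    unmodified : ¬ Any (Modifies b) _
    unmodified = ¬modified-after-test rzt
      ((run ++ᴾ Steps⇒CPath loop) ++ᴾ Steps⇒CPath loop) (++⁺ʳ τ tested)

  replay-loop : RestrictedZeroTests M → ∀ {x x' σ} →
    Reachable (Step M) (initial M) x → Steps (Step M) x σ x' → _≼_ M x x' →
    ∃ λ y → Steps (Step M) x' σ y × _≼_ M x' y × (_≼_ M y x' → _≼_ M x' x)
  replay-loop rzt {q , v} {.q , v'} reach loop (refl , v≤v')
    with Steps-⊕ (v' ⊖ v) loop (loop-gain-untested rzt reach loop)
                 (λ b → sym (m+[n∸m]≡n (v≤v' b)))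
  ... | w , replay , w≗ = (q , w) , replay , (refl , v'≤w) , w≤v'⇒v'≤v
    where
    v'≤w : ∀ b → v' b ≤ w b
    v'≤w b = subst (v' b ≤_) (sym (w≗ b)) (m≤m+n (v' b) _)

    w≤v'⇒v'≤v : _≼_ M (q , w) (q , v') → _≼_ M (q , v') (q , v)
    w≤v'⇒v'≤v (_ , w≤v') =
      refl , λ b → m+[n∸o]≤m⇒n≤o (v' b) (subst (_≤ v' b) (w≗ b) (w≤v' b))

proposition4p1 : (M : CounterMachine) → RestrictedZeroTests M →
    BranchMonotone (Step M) (_≼_ M) (initial M)
    × StrictlyBranchMonotone (Step M) (_≼_ M) (initial M)
proposition4p1 M rzt = monotone , strictlyMonotone
  where
  monotone : BranchMonotone (Step M) (_≼_ M) (initial M)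
  monotone _ _ _ reach loop x≼x' with replay-loop M rzt reach loop x≼x'
  ... | y , replay , x'≼y , _ = y , replay , x'≼y

  strictlyMonotone : StrictlyBranchMonotone (Step M) (_≼_ M) (initial M)
  strictlyMonotone _ _ _ reach loop (x≼x' , x'⋠x) with replay-loop M rzt reach loop x≼x'
  ... | y , replay , x'≼y , y≼x'⇒x'≼x = y , replay , x'≼y , x'⋠x ∘′ y≼x'⇒x'≼x
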